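{- Let $(\mathbb{X},\dagger)$ be a dagger category with finite $\dagger$-biproducts, and suppose $f: A\to B$ has a generalized singular value decomposition $(u: A\to X\oplus Z, d: X\to Y, v: Y\oplus W\to B)$. Then $(u\pi_1: A\to X, d: X\to Y, \iota_1 v: Y\to B)$ is a generalized compact singular value decomposition of $f$, and therefore $f$ is Moore-Penrose split with Moore-Penrose inverse $f^\circ = v^\dagger(d^{ -1}\oplus 0)u^\dagger$.
   Context: Composition is in diagrammatic order. A dagger category is a category with an identity-on-objects contravariant involutive functor $\dagger$. Isometry: $s: A \to B$ with $ss^\dagger = 1_A$; coisometry: $r: A\to B$ with $r^\dagger r = 1_B$; unitary: both. Finite $\dagger$-biproducts: finite biproducts $\oplus$ with projections $\pi_j$ and injections $\iota_j$ such that $\pi_j^\dagger = \iota_j$. A Moore-Penrose inverse of $f: A\to B$ is $f^\circ: B\to A$ with $ff^\circ f = f$, $f^\circ f f^\circ = f^\circ$, $(ff^\circ)^\dagger = ff^\circ$, $(f^\circ f)^\dagger = f^\circ f$. A $\dagger$-idempotent $e$ $\dagger$-splits if $e = rr^\dagger$ with $r^\dagger r = 1$; $f$ is Moore-Penrose split if it has a Moore-Penrose inverse $f^\circ$ and $ff^\circ$ and $f^\circ f$ both $\dagger$-split. A generalized singular value decomposition of $f$ is a triple $(u: A\to X\oplus Z, d: X\to Y, v: Y\oplus W\to B)$ with $u,v$ unitary, $d$ an isomorphism and $f = u(d\oplus 0)v$ (here $0: Z\to W$ is the zero map). A generalized compact singular value decomposition of $f$ is a triple $(r: A\to X, d: X\to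 Y, s: Y\to B)$ with $r$ a coisometry, $d$ an isomorphism, $s$ an isometry and $f = rds$. -}

module Defs where

open import Level using (Level; _⊔_; suc)
open import Data.Product using (Σ; _×_; _,_)
open import Relation.Binary.Structures using (IsEquivalence)

-- A dagger category with finite dagger-biproducts.
-- Composition is written in DIAGRAMMATIC order:  f ▸ g  means "first f, then g".
-- Hom-sets are setoids (equality of morphisms is _≈_).
record DaggerBiproductCategory (o ℓ e : Level) : Set (suc (o ⊔ ℓ ⊔ e)) where
  infixr 9 _▸_
  infix  4 _≈_
  infixr 7 _⊕_
  field
    Obj  : Set o
    Hom  : Obj → Obj → Set ℓ
    _≈_  : ∀ {A B} → Hom A B → Hom A B → Set e
    ≈-equiv : ∀ {A B} → IsEquivalence (_≈_ {A} {B})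
    id   : ∀ {A} → Hom A A
    _▸_  : ∀ {A B C} → Hom A B → Hom B C → Hom A C
    ▸-cong : ∀ {A B C} {f f' : Hom A B} {g g' : Hom B C} →
             f ≈ f' → g ≈ g' → f ▸ g ≈ f' ▸ g'
    assoc  : ∀ {A B C D} (f : Hom A B) (g : Hom B C) (h : Hom C D) →
             (f ▸ g) ▸ h ≈ f ▸ (g ▸ h)
    idˡ    : ∀ {A B} (f : Hom A B) → id ▸ f ≈ f
    idʳ    : ∀ {A B} (f : Hom A B) → f ▸ id ≈ f
    _†     : ∀ {A B} → Hom A B → Hom B A
    †-cong : ∀ {A B} {f g : Hom A B} → f ≈ g → f † ≈ g †
    †-id   : ∀ {A} → (id {A}) † ≈ id
    †-▸    : ∀ {A B C} (f : Hom A B) (g : Hom B C) → (f ▸ g) † ≈ g † ▸ f †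
    †-invol : ∀ {A B} (f : Hom A B) → (f †) † ≈ f
    𝟘    : Obj
    !    : ∀ {A} → Hom A 𝟘
    ¡    : ∀ {A} → Hom 𝟘 A
    !-unique : ∀ {A} (h : Hom A 𝟘) → h ≈ !
    ¡-unique : ∀ {A} (h : Hom 𝟘 A) → h ≈ ¡

  0m : ∀ {A B} → Hom A B
  0m = ! ▸ ¡

  field
    _⊕_  : Obj → Obj → Obj
    π₁   : ∀ {A B} → Hom (A ⊕ B) A
    π₂   : ∀ {A B} → Hom (A ⊕ B) B
    ι₁   : ∀ {A B} → Hom A (A ⊕ B)
    ι₂   : ∀ {A B} → Hom B (A ⊕ B)
    ⟨_,_⟩ : ∀ {C A B} → Hom C A → Hom C B → Hom C (A ⊕ B)
    ⟨⟩-π₁ : ∀ {C A B} (f : Hom C A) (g : Hom C B) → ⟨ f , g ⟩ ▸ π₁ ≈ f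
    ⟨⟩-π₂ : ∀ {C A B} (f : Hom C A) (g : Hom C B) → ⟨ f , g ⟩ ▸ π₂ ≈ g
    ⟨⟩-unique : ∀ {C A B} {f : Hom C A} {g : Hom C B} (h : Hom C (A ⊕ B)) →
                h ▸ π₁ ≈ f → h ▸ π₂ ≈ g → h ≈ ⟨ f , g ⟩
    [_,_] : ∀ {A B C} → Hom A C → Hom B C → Hom (A ⊕ B) C
    ι₁-[] : ∀ {A B C} (f : Hom A C) (g : Hom B C) → ι₁ ▸ [ f , g ] ≈ f
    ι₂-[] : ∀ {A B C} (f : Hom A C) (g : Hom B C) → ι₂ ▸ [ f , g ] ≈ g
    []-unique : ∀ {A B C} {f : Hom A C} {g : Hom B C} (h : Hom (A ⊕ B) C) →
                ι₁ ▸ h ≈ f → ι₂ ▸ h ≈ g → h ≈ [ f , g ]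
    ι₁π₁ : ∀ {A B} → ι₁ {A} {B} ▸ π₁ ≈ id
    ι₂π₂ : ∀ {A B} → ι₂ {A} {B} ▸ π₂ ≈ id
    ι₁π₂ : ∀ {A B} → ι₁ {A} {B} ▸ π₂ ≈ 0m
    ι₂π₁ : ∀ {A B} → ι₂ {A} {B} ▸ π₁ ≈ 0m
    π₁† : ∀ {A B} → (π₁ {A} {B}) † ≈ ι₁
    π₂† : ∀ {A B} → (π₂ {A} {B}) † ≈ ι₂

  _⊕₁_ : ∀ {A B C D} → Hom A C → Hom B D → Hom (A ⊕ B) (C ⊕ D)
  f ⊕₁ g = ⟨ π₁ ▸ f , π₂ ▸ g ⟩

  IsIsometry : ∀ {A B} → Hom A B → Set e
  IsIsometry s = s ▸ s † ≈ id

  IsCoisometry : ∀ {A B} → Hom A B → Set e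
  IsCoisometry r = r † ▸ r ≈ id

  IsUnitary : ∀ {A B} → Hom A B → Set e
  IsUnitary u = IsIsometry u × IsCoisometry u

  record IsIso {A B} (d : Hom A B) : Set (ℓ ⊔ e) where
    field
      inv   : Hom B A
      isoˡ  : d ▸ inv ≈ id
      isoʳ  : inv ▸ d ≈ id

  record IsMPInverse {A B} (f : Hom A B) (f° : Hom B A) : Set e where
    field
      mp1 : f ▸ f° ▸ f ≈ f
      mp2 : f° ▸ f ▸ f° ≈ f°
      mp3 : (f ▸ f°) † ≈ f ▸ f°
      mp4 : (f° ▸ f) † ≈ f° ▸ f

  DaggerSplits : ∀ {A} → Hom A A → Set (o ⊔ ℓ ⊔ e)
  DaggerSplits {A} p = Σ Obj λ C → Σ (Hom A C) λ r → (p ≈ r ▸ r †) × (r † ▸ r ≈ id)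

  IsMPSplitWith : ∀ {A B} → Hom A B → Hom B A → Set (o ⊔ ℓ ⊔ e)
  IsMPSplitWith f f° = IsMPInverse f f° × DaggerSplits (f ▸ f°) × DaggerSplits (f° ▸ f)

  record IsGSVD {A B X Y Z W} (f : Hom A B)
                (u : Hom A (X ⊕ Z)) (d : Hom X Y) (v : Hom (Y ⊕ W) B) : Set (ℓ ⊔ e) where
    field
      u-unitary : IsUnitary u
      d-iso     : IsIso d
      v-unitary : IsUnitary v
      factor    : f ≈ u ▸ (d ⊕₁ 0m {Z} {W}) ▸ v

  record IsGCSVD {A B X Y} (f : Hom A B)
                 (r : Hom A X) (d : Hom X Y) (s : Hom Y B) : Set (ℓ ⊔ e) where
    field
      r-coisometry : IsCoisometry r
      d-iso        : IsIso d
      s-isometry   : IsIsometry s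
      factor       : f ≈ r ▸ d ▸ s

{-# OPTIONS --safe #-}
-- Since u is unitary and d ⊕ 0 = π₁ d ι₁, the factorisation f = u (d ⊕ 0) v regroups as
-- (u π₁) d (ι₁ v), where u π₁ is a coisometry and ι₁ v an isometry.  For any compact
-- factorisation f = r d s put g = s† d⁻¹ r†: the inner factors cancel, so f g = r r† and
-- g f = s† s are dagger-split projections, and the Moore-Penrose equations follow.
module Submission where

open import Defs
open import Data.Product using (_×_; _,_; proj₁; proj₂)
open import Relation.Binary.Bundles using (Setoid)
import Relation.Binary.Reasoning.Setoid as SetoidReasoning

module Properties {o ℓ e} (𝕏 : DaggerBiproductCategory o ℓ e) where
  open DaggerBiproductCategory 𝕏

  homSetoid : Obj → Obj → Setoid ℓ e
  homSetoid A B = record { Carrier = Hom A B ; _≈_ = _≈_ ; isEquivalence = ≈-equiv }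

  module _ {A B : Obj} where
    open Setoid (homSetoid A B) public using () renaming (refl to ≈-refl; sym to ≈-sym; trans to ≈-trans)

  module HomReasoning {A B : Obj} = SetoidReasoning (homSetoid A B)

  ▸-congˡ : ∀ {A B C} {f f' : Hom A B} {g : Hom B C} → f ≈ f' → f ▸ g ≈ f' ▸ g
  ▸-congˡ p = ▸-cong p ≈-refl

  ▸-congʳ : ∀ {A B C} {f : Hom A B} {g g' : Hom B C} → g ≈ g' → f ▸ g ≈ f ▸ g'
  ▸-congʳ p = ▸-cong ≈-refl p

  cancelˡ : ∀ {A B C} {x : Hom A B} {y : Hom B A} (h : Hom A C) → x ▸ y ≈ id → x ▸ y ▸ h ≈ h
  cancelˡ {x = x} {y} h xy = ≈-trans (≈-sym (assoc x y h)) (≈-trans (▸-congˡ xy) (idˡ h))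

  cancel-inner : ∀ {A B C D} (a : Hom A B) {x : Hom B C} {y : Hom C B} (h : Hom B D) →
                 x ▸ y ≈ id → (a ▸ x) ▸ (y ▸ h) ≈ a ▸ h
  cancel-inner a {x} h xy = ≈-trans (assoc a x _) (▸-congʳ (cancelˡ h xy))

  ▸-zeroʳ : ∀ {A B C} (f : Hom A B) → f ▸ 0m {B} {C} ≈ 0m
  ▸-zeroʳ f = ≈-trans (≈-sym (assoc f ! ¡)) (▸-congˡ (!-unique _))

  ι₁† : ∀ {A B} → ι₁ {A} {B} † ≈ π₁
  ι₁† = ≈-trans (†-cong (≈-sym π₁†)) (†-invol π₁)

  π₁-coisometry : ∀ {A B} → IsCoisometry (π₁ {A} {B})
  π₁-coisometry = ≈-trans (▸-congˡ π₁†) ι₁π₁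

  ι₁-isometry : ∀ {A B} → IsIsometry (ι₁ {A} {B})
  ι₁-isometry = ≈-trans (▸-congʳ ι₁†) ι₁π₁

  coisometry-▸ : ∀ {A B C} {r : Hom A B} {s : Hom B C} →
                 IsCoisometry r → IsCoisometry s → IsCoisometry (r ▸ s)
  coisometry-▸ {r = r} {s} r-co s-co = begin
    (r ▸ s) † ▸ r ▸ s     ≈⟨ ▸-congˡ (†-▸ r s) ⟩
    (s † ▸ r †) ▸ r ▸ s   ≈⟨ cancel-inner (s †) s r-co ⟩
    s † ▸ s               ≈⟨ s-co ⟩
    id                    ∎
    where open HomReasoning

  isometry-▸ : ∀ {A B C} {r : Hom A B} {s : Hom B C} →
               IsIsometry r → IsIsometry s → IsIsometry (r ▸ s)
  isometry-▸ {r = r} {s} r-iso s-iso = begin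
    (r ▸ s) ▸ (r ▸ s) †   ≈⟨ ▸-congʳ (†-▸ r s) ⟩
    (r ▸ s) ▸ s † ▸ r †   ≈⟨ cancel-inner r (r †) s-iso ⟩
    r ▸ r †               ≈⟨ r-iso ⟩
    id                    ∎
    where open HomReasoning

  isometry⇒†-coisometry : ∀ {A B} {s : Hom A B} → IsIsometry s → IsCoisometry (s †)
  isometry⇒†-coisometry {s = s} s-iso = ≈-trans (▸-congˡ (†-invol s)) s-iso

  ▸†-self-adjoint : ∀ {A B} (h : Hom A B) → (h ▸ h †) † ≈ h ▸ h †
  ▸†-self-adjoint h = ≈-trans (†-▸ h (h †)) (▸-congˡ (†-invol h))

  ⊕₁-zeroʳ : ∀ {A B C D} (a : Hom A C) → a ⊕₁ 0m {B} {D} ≈ π₁ ▸ a ▸ ι₁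
  ⊕₁-zeroʳ a = ≈-sym (⟨⟩-unique _ first second)
    where
    open HomReasoning
    first : (π₁ ▸ a ▸ ι₁) ▸ π₁ ≈ π₁ ▸ a
    first = begin
      (π₁ ▸ a ▸ ι₁) ▸ π₁     ≈⟨ assoc π₁ _ π₁ ⟩
      π₁ ▸ (a ▸ ι₁) ▸ π₁     ≈⟨ ▸-congʳ (assoc a ι₁ π₁) ⟩
      π₁ ▸ a ▸ ι₁ ▸ π₁       ≈⟨ ▸-congʳ (▸-congʳ ι₁π₁) ⟩
      π₁ ▸ a ▸ id            ≈⟨ ▸-congʳ (idʳ a) ⟩
      π₁ ▸ a                 ∎
    second : (π₁ ▸ a ▸ ι₁) ▸ π₂ ≈ π₂ ▸ 0m
    second = begin
      (π₁ ▸ a ▸ ι₁) ▸ π₂     ≈⟨ assoc π₁ _ π₂ ⟩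
      π₁ ▸ (a ▸ ι₁) ▸ π₂     ≈⟨ ▸-congʳ (assoc a ι₁ π₂) ⟩
      π₁ ▸ a ▸ ι₁ ▸ π₂       ≈⟨ ▸-congʳ (▸-congʳ ι₁π₂) ⟩
      π₁ ▸ a ▸ 0m            ≈⟨ ▸-congʳ (▸-zeroʳ a) ⟩
      π₁ ▸ 0m                ≈⟨ ▸-zeroʳ π₁ ⟩
      0m                     ≈⟨ ▸-zeroʳ π₂ ⟨
      π₂ ▸ 0m                ∎

  -- Stated for a coisometry a and arbitrary one-sided inverses b', c', so that it applies to
  -- both f g (with a = r) and g f (with a = s†).
  compact-product : ∀ {A B C D} {f : Hom A D} {g : Hom D A}
                    {a : Hom A B} {b : Hom B C} {b' : Hom C B} {c : Hom C D} {c' : Hom D C} →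
                    IsCoisometry a → b ▸ b' ≈ id → c ▸ c' ≈ id →
                    f ≈ a ▸ b ▸ c → g ≈ c' ▸ b' ▸ a † →
                    (f ▸ g ≈ a ▸ a †) × (f ▸ g ▸ f ≈ f)
  compact-product {f = f} {g} {a} {b} {b'} {c} {c'} a-co bb' cc' f≈ g≈ = fg , fgf
    where
    open HomReasoning
    fg : f ▸ g ≈ a ▸ a †
    fg = begin
      f ▸ g                                ≈⟨ ▸-cong f≈ g≈ ⟩
      (a ▸ b ▸ c) ▸ (c' ▸ b' ▸ a †)        ≈⟨ ▸-congˡ (assoc a b c) ⟨
      ((a ▸ b) ▸ c) ▸ (c' ▸ b' ▸ a †)      ≈⟨ cancel-inner (a ▸ b) (b' ▸ a †) cc' ⟩
      (a ▸ b) ▸ (b' ▸ a †)                 ≈⟨ cancel-inner a (a †) bb' ⟩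
      a ▸ a †                              ∎
    fgf : f ▸ g ▸ f ≈ f
    fgf = begin
      f ▸ g ▸ f              ≈⟨ assoc f g f ⟨
      (f ▸ g) ▸ f            ≈⟨ ▸-cong fg f≈ ⟩
      (a ▸ a †) ▸ a ▸ b ▸ c  ≈⟨ cancel-inner a (b ▸ c) a-co ⟩
      a ▸ b ▸ c              ≈⟨ f≈ ⟨
      f                      ∎

  gcsvd⇒mp-split : ∀ {A B X Y} {f : Hom A B} {r : Hom A X} {d : Hom X Y} {s : Hom Y B} {g : Hom B A} →
                   (csvd : IsGCSVD f r d s) →
                   g ≈ s † ▸ IsIso.inv (IsGCSVD.d-iso csvd) ▸ r † →
                   IsMPSplitWith f g
  gcsvd⇒mp-split {r = r} {s = s} csvd g≈ =
    record { mp1 = proj₂ fg-split ; mp2 = proj₂ gf-split ; mp3 = self-adjoint (proj₁ fg-split)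
           ; mp4 = self-adjoint (proj₁ gf-split) }
    , (_ , r , proj₁ fg-split , r-coisometry)
    , (_ , s † , proj₁ gf-split , isometry⇒†-coisometry s-isometry)
    where
    open IsGCSVD csvd
    open IsIso d-iso
    self-adjoint : ∀ {C D} {p : Hom C C} {h : Hom C D} → p ≈ h ▸ h † → p † ≈ p
    self-adjoint {h = h} p≈ = ≈-trans (†-cong p≈) (≈-trans (▸†-self-adjoint h) (≈-sym p≈))
    fg-split = compact-product r-coisometry isoˡ s-isometry factor g≈
    gf-split = compact-product (isometry⇒†-coisometry s-isometry) isoʳ r-coisometry g≈
                 (≈-trans factor (▸-congʳ (▸-congʳ (≈-sym (†-invol s)))))

  gsvd⇒gcsvd : ∀ {A B X Y Z W} {f : Hom A B} {u : Hom A (X ⊕ Z)} {d : Hom X Y} {v : Hom (Y ⊕ W) B} →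
               (svd : IsGSVD f u d v) → IsGCSVD f (u ▸ π₁) d (ι₁ ▸ v)
  gsvd⇒gcsvd {f = f} {u} {d} {v} svd = record
    { r-coisometry = coisometry-▸ (proj₂ u-unitary) π₁-coisometry
    ; d-iso        = d-iso
    ; s-isometry   = isometry-▸ ι₁-isometry (proj₁ v-unitary)
    ; factor       = begin
        f                          ≈⟨ factor ⟩
        u ▸ (d ⊕₁ 0m) ▸ v          ≈⟨ ▸-congʳ (▸-congˡ (⊕₁-zeroʳ d)) ⟩
        u ▸ (π₁ ▸ d ▸ ι₁) ▸ v      ≈⟨ ▸-congʳ (assoc π₁ _ v) ⟩
        u ▸ π₁ ▸ (d ▸ ι₁) ▸ v      ≈⟨ ▸-congʳ (▸-congʳ (assoc d ι₁ v)) ⟩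
        u ▸ π₁ ▸ d ▸ ι₁ ▸ v        ≈⟨ assoc u π₁ _ ⟨
        (u ▸ π₁) ▸ d ▸ ι₁ ▸ v      ∎
    }
    where
    open IsGSVD svd
    open HomReasoning

  gsvd-inverse-compact : ∀ {A B X Y Z W} (u : Hom A (X ⊕ Z)) (d' : Hom Y X) (v : Hom (Y ⊕ W) B) →
                         v † ▸ (d' ⊕₁ 0m {W} {Z}) ▸ u † ≈ (ι₁ ▸ v) † ▸ d' ▸ (u ▸ π₁) †
  gsvd-inverse-compact u d' v = begin
    v † ▸ (d' ⊕₁ 0m) ▸ u †           ≈⟨ ▸-congʳ (▸-congˡ (⊕₁-zeroʳ d')) ⟩
    v † ▸ (π₁ ▸ d' ▸ ι₁) ▸ u †       ≈⟨ ▸-congʳ (assoc π₁ _ (u †)) ⟩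
    v † ▸ π₁ ▸ (d' ▸ ι₁) ▸ u †       ≈⟨ ▸-congʳ (▸-congʳ (assoc d' ι₁ (u †))) ⟩
    v † ▸ π₁ ▸ d' ▸ ι₁ ▸ u †         ≈⟨ assoc (v †) π₁ _ ⟨
    (v † ▸ π₁) ▸ d' ▸ ι₁ ▸ u †       ≈⟨ ▸-cong (▸-congʳ ι₁†) (▸-congʳ (▸-congˡ π₁†)) ⟨
    (v † ▸ ι₁ †) ▸ d' ▸ π₁ † ▸ u †   ≈⟨ ▸-cong (†-▸ ι₁ v) (▸-congʳ (†-▸ u π₁)) ⟨
    (ι₁ ▸ v) † ▸ d' ▸ (u ▸ π₁) †     ∎
    where open HomReasoning

mainTheorem6 : ∀ {o ℓ e} (𝕏 : DaggerBiproductCategory o ℓ e) →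
    let open DaggerBiproductCategory 𝕏 in
    ∀ {A B X Y Z W} (f : Hom A B)
      (u : Hom A (X ⊕ Z)) (d : Hom X Y) (v : Hom (Y ⊕ W) B) →
    (svd : IsGSVD f u d v) →
    IsGCSVD f (u ▸ π₁) d (ι₁ ▸ v)
      × IsMPSplitWith f (v † ▸ (IsIso.inv (IsGSVD.d-iso svd) ⊕₁ 0m {W} {Z}) ▸ u †)
mainTheorem6 𝕏 f u d v svd =
  gsvd⇒gcsvd svd , gcsvd⇒mp-split (gsvd⇒gcsvd svd) (gsvd-inverse-compact u _ v)
  where open Properties 𝕏
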